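{- Let $N=(B,E,F)$ be a K-dense, interval-finite and degree-finite occurrence net, and let $Y\subseteq B\cup E$. Then $Y$ is a causally closed set of $N$ if and only if $Y$ is a closed set of the associated poset, i.e. $Y=Y^{\perp\perp}$.
   Context: A net is a triple $N=(B,E,F)$ with $B,E$ countable disjoint sets (conditions and events), $F\subseteq(B\times E)\cup(E\times B)$, such that every event $e$ has some $x,y\in B$ with $(x,e)\in F$ and $(e,y)\in F$. For $x\in B\cup E$, ${}^\bullet x=\{y\mid (y,x)\in F\}$ and $x^\bullet=\{y\mid (x,y)\in F\}$. $N$ is an occurrence net if every $b\in B$ has $|{}^\bullet b|\le 1$ and $|b^\bullet|\le1$, and $(x,y)\in F^+\Rightarrow (y,x)\notin F^+$. Its associated poset is $(X,\sqsubseteq)$ with $X=B\cup E$, $\sqsubseteq=F^*$. $x\ li\ y$ iff $x\sqsubseteq y$ or $y\sqsubseteq x$; $x\ co\ y$ iff not $x\ li\ y$. For $S\subseteq X$, $S^\perp=\{x\in X\mid \forall y\in S: x\ co\ y\}$; $S$ is closed if $S=(S^\perp)^\perp$. A cut is a maximal subset of pairwise $co$ elements; a line is a maximal subset of pairwise $li$ elements; $N$ is K-dense if every cut intersects every line. $N$ is interval-finite if all intervals $[x,y]$ of $\sqsubseteq$ are finite, degree-finite if every element has finitely many immediate predecessors and successors. A set $C\subseteq B\cup E$ is causally closed iff: (i) for all $e\in E$, ${}^\bullet e\subseteq C\Rightarrow e\in C$; (ii) for all $e\in E$, $e^\bullet\subseteq C\Rightarrow e\in C$; (iii) for all $e\in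 E$, $e\in C\Rightarrow {}^\bullet e\cup e^\bullet\subseteq C$; (iv) for all $x,y\in C$ with $x\ li\ y$, every element lying between $x$ and $y$ in $\sqsubseteq$ belongs to $C$. -}

module Defs where

open import Level using (0ℓ)
open import Data.Nat using (ℕ)
open import Data.Sum using (_⊎_; inj₁; inj₂)
open import Data.Product using (_×_; Σ; ∃; _,_)
open import Data.List using (List)
open import Data.List.Membership.Propositional using (_∈_)
open import Relation.Nullary using (¬_)
open import Relation.Binary.PropositionalEquality using (_≡_)
open import Relation.Binary.Construct.Closure.ReflexiveTransitive using (Star)
open import Relation.Binary.Construct.Closure.Transitive using (TransClosure)
open import Function.Definitions using (Injective)

-- A net N = (B, E, F). B and E are countable (injection into ℕ);
-- disjointness is built in since the elements are B ⊎ E.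
-- F ⊆ (B × E) ∪ (E × B) is given by its two components FBE, FEB.
record Net : Set₁ where
  field
    B : Set
    E : Set
    FBE : B → E → Set
    FEB : E → B → Set
    B-countable : Σ (B → ℕ) λ f → Injective _≡_ _≡_ f
    E-countable : Σ (E → ℕ) λ f → Injective _≡_ _≡_ f
    event-pre  : ∀ e → ∃ λ x → FBE x e
    event-post : ∀ e → ∃ λ y → FEB e y

  X : Set
  X = B ⊎ E

  data F : X → X → Set where
    be : ∀ {b e} → FBE b e → F (inj₁ b) (inj₂ e)
    eb : ∀ {e b} → FEB e b → F (inj₂ e) (inj₁ b)

  _⊑_ : X → X → Set
  _⊑_ = Star F

  _⊏_ : X → X → Set
  x ⊏ y = (x ⊑ y) × ¬ (x ≡ y)

  _li_ : X → X → Set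
  x li y = (x ⊑ y) ⊎ (y ⊑ x)

  _co_ : X → X → Set
  x co y = ¬ (x li y)

  Subset : Set₁
  Subset = X → Set

  _⊥ : Subset → Subset
  (S ⊥) x = ∀ y → S y → x co y

  SameSet : Subset → Subset → Set
  SameSet S T = (∀ x → S x → T x) × (∀ x → T x → S x)

  Closed : Subset → Set
  Closed S = SameSet S ((S ⊥) ⊥)

  Cut : Subset → Set
  Cut S = (∀ x y → S x → S y → ¬ (x ≡ y) → x co y)
        × (∀ x → ¬ S x → ¬ (∀ y → S y → x co y))

  Line : Subset → Set
  Line S = (∀ x y → S x → S y → x li y)
         × (∀ x → ¬ S x → ¬ (∀ y → S y → x li y))

  KDense : Set₁
  KDense = ∀ c l → Cut c → Line l → ∃ λ x → c x × l x

  Finite : Subset → Set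
  Finite S = ∃ λ (xs : List X) → ∀ x → S x → x ∈ xs

  IntervalFinite : Set
  IntervalFinite = ∀ x y → Finite (λ z → (x ⊑ z) × (z ⊑ y))

  ImmPred : X → Subset
  ImmPred x y = (y ⊏ x) × (∀ z → ¬ ((y ⊏ z) × (z ⊏ x)))

  ImmSucc : X → Subset
  ImmSucc x y = (x ⊏ y) × (∀ z → ¬ ((x ⊏ z) × (z ⊏ y)))

  DegreeFinite : Set
  DegreeFinite = ∀ x → Finite (ImmPred x) × Finite (ImmSucc x)

  IsOccurrenceNet : Set
  IsOccurrenceNet =
      (∀ b e e′ → FEB e b → FEB e′ b → e ≡ e′)
    × (∀ b e e′ → FBE b e → FBE b e′ → e ≡ e′)
    × (∀ x y → TransClosure F x y → ¬ TransClosure F y x)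

  CausallyClosed : Subset → Set
  CausallyClosed C =
      (∀ e → (∀ b → FBE b e → C (inj₁ b)) → C (inj₂ e))
    × (∀ e → (∀ b → FEB e b → C (inj₁ b)) → C (inj₂ e))
    × (∀ e → C (inj₂ e) → (∀ b → FBE b e → C (inj₁ b))
                        × (∀ b → FEB e b → C (inj₁ b)))
    × (∀ x y z → C x → C y → x li y
         → ((x ⊑ z) × (z ⊑ y)) ⊎ ((y ⊑ z) × (z ⊑ x)) → C z)

module Submission where

open import Defs
open import Level using (0ℓ)
open import Axiom.ExcludedMiddle using (ExcludedMiddle)
open import Axiom.DoubleNegationElimination using (em⇒dne)
open import Data.Empty using (⊥-elim) renaming (⊥ to Empty)
open import Data.Product using (_×_; Σ; ∃; ∃₂; _,_; proj₁; proj₂; swap)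
open import Data.Sum using (_⊎_; inj₁; inj₂)
open import Data.Nat using (ℕ; zero; suc; _*_; _<_; _≤′_; ≤′-reflexive; ≤′-step)
open import Data.Nat.Properties
  using (≤-total; ≤⇒≤′; n<1+n; *-cancelˡ-≡; even≢odd; suc-injective)
  renaming (_≟_ to _≟ℕ_)
open import Data.List using (length; lookup)
open import Data.List.Membership.Propositional using (_∈_)
open import Data.List.Relation.Unary.Any using (index)
open import Data.List.Relation.Unary.Any.Properties using (lookup-index)
open import Data.Fin as Fin using (Fin; toℕ)
open import Data.Fin.Properties using (pigeonhole)
open import Function.Definitions using (Injective)
open import Relation.Nullary using (¬_; yes; no)
open import Relation.Nullary.Decidable using (map′)
open import Relation.Binary.Definitions using (Sym; Symmetric; DecidableEquality)
open import Relation.Binary.PropositionalEquality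
  using (_≡_; _≢_; refl; sym; trans; cong; subst; module ≡-Reasoning)
open import Relation.Binary.Construct.Closure.ReflexiveTransitive
  using (Star; ε; _◅_; _◅◅_; reverse)
open import Relation.Binary.Construct.Closure.Transitive using (TransClosure; [_]; _∷_; _∷ʳ_)

-- Closed sets are causally closed because every S⊥ is. Conversely, let Y be
-- causally closed and x ∈ Y⊥⊥ ∖ Y, say above some element of Y (the case
-- below is the same argument in the reversed net). Nothing of Y lies above x,
-- and every element with that property below x has an immediate predecessor
-- with it too: either the last step into it from Y, or, if that step leaves Y
-- at a condition, an input condition of the same event that is outside Y.
-- This yields an infinite descending chain below x. The conditions of Y with
-- an output event outside Y are pairwise concurrent, and every link of the
-- chain lies above one of them; a cut through them meets a line through the
-- chain in a lower bound of the whole chain, so the interval from that bound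
-- to x is infinite.

-- A maximal extension without Zorn's lemma: run through A in the order of the
-- codes and add each element that is compatible with everything added so far.
module GreedyExtension
    {A : Set} (code : A → ℕ) (code-injective : Injective _≡_ _≡_ code)
    (_R_ : A → A → Set) (R-sym : Symmetric _R_)
    (S : A → Set) (S-pairwise : ∀ x y → S x → S y → x ≢ y → x R y) where

  Compatible : (A → Set) → A → Set
  Compatible P z = ∀ y → P y → z ≢ y → z R y

  Added : ℕ → A → Set
  Added zero    z = Empty
  Added (suc n) z = Added n z ⊎ (code z ≡ n × Compatible S z × Compatible (Added n) z)

  Extension : A → Set
  Extension z = S z ⊎ ∃ λ n → Added n z

  added-compatible : ∀ n {z} → Added n z → Compatible S z
  added-compatible (suc n) (inj₁ a)           = added-compatible n a
  added-compatible (suc n) (inj₂ (_ , c , _)) = c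

  added-weaken : ∀ {m n z} → m ≤′ n → Added m z → Added n z
  added-weaken (≤′-reflexive refl) a = a
  added-weaken (≤′-step m≤n)       a = inj₁ (added-weaken m≤n a)

  added-pairwise : ∀ n {x y} → Added n x → Added n y → x ≢ y → x R y
  added-pairwise (suc n) (inj₁ a) (inj₁ b)           x≢y = added-pairwise n a b x≢y
  added-pairwise (suc n) (inj₁ a) (inj₂ (_ , _ , c)) x≢y =
    R-sym (c _ a (λ y≡x → x≢y (sym y≡x)))
  added-pairwise (suc n) (inj₂ (_ , _ , c)) (inj₁ b) x≢y = c _ b x≢y
  added-pairwise (suc n) (inj₂ (cx , _)) (inj₂ (cy , _)) x≢y =
    ⊥-elim (x≢y (code-injective (trans cx (sym cy))))

  extension-pairwise : ∀ x y → Extension x → Extension y → x ≢ y → x R y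
  extension-pairwise x y (inj₁ s) (inj₁ t) x≢y = S-pairwise x y s t x≢y
  extension-pairwise x y (inj₁ s) (inj₂ (n , b)) x≢y =
    R-sym (added-compatible n b x s (λ y≡x → x≢y (sym y≡x)))
  extension-pairwise x y (inj₂ (n , a)) (inj₁ t) x≢y = added-compatible n a y t x≢y
  extension-pairwise x y (inj₂ (m , a)) (inj₂ (n , b)) x≢y with ≤-total m n
  ... | inj₁ m≤n = added-pairwise n (added-weaken (≤⇒≤′ m≤n) a) b x≢y
  ... | inj₂ n≤m = added-pairwise m a (added-weaken (≤⇒≤′ n≤m) b) x≢y

  extension-maximal : ∀ z → ¬ Extension z → ¬ (∀ y → Extension y → z R y)
  extension-maximal z z∉ compatible = z∉ (inj₂ (suc (code z) , inj₂ (refl ,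
    (λ y s _ → compatible y (inj₁ s)) , (λ y a _ → compatible y (inj₂ (code z , a))))))

module NetProperties (N : Net) where
  open Net N

  code : X → ℕ
  code (inj₁ b) = 2 * proj₁ B-countable b
  code (inj₂ e) = suc (2 * proj₁ E-countable e)

  code-injective : Injective _≡_ _≡_ code
  code-injective {inj₁ a} {inj₁ b} p = cong inj₁ (proj₂ B-countable (*-cancelˡ-≡ _ _ 2 p))
  code-injective {inj₁ b} {inj₂ e} p =
    ⊥-elim (even≢odd (proj₁ B-countable b) (proj₁ E-countable e) p)
  code-injective {inj₂ e} {inj₁ b} p =
    ⊥-elim (even≢odd (proj₁ B-countable b) (proj₁ E-countable e) (sym p))
  code-injective {inj₂ e} {inj₂ f} p =
    cong inj₂ (proj₂ E-countable (*-cancelˡ-≡ _ _ 2 (suc-injective p)))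

  _≟_ : DecidableEquality X
  x ≟ y = map′ code-injective (cong code) (code x ≟ℕ code y)

  li-sym : Symmetric _li_
  li-sym (inj₁ p) = inj₂ p
  li-sym (inj₂ p) = inj₁ p

  co-sym : Symmetric _co_
  co-sym x-co-y y-li-x = x-co-y (li-sym y-li-x)

  ⊑-unsnoc : ∀ {x z} → x ⊑ z → x ≡ z ⊎ ∃ λ v → x ⊑ v × F v z
  ⊑-unsnoc ε = inj₁ refl
  ⊑-unsnoc (f ◅ r) with ⊑-unsnoc r
  ... | inj₁ refl          = inj₂ (_ , ε , f)
  ... | inj₂ (v , s , g)   = inj₂ (v , f ◅ s , g)

  ⊆-⊥⊥ : (S : Subset) → ∀ x → S x → ((S ⊥) ⊥) x
  ⊆-⊥⊥ S x Sx w w∈S⊥ = co-sym (w∈S⊥ x Sx)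

  ⊥⊥-comparable : ExcludedMiddle 0ℓ → ∀ {S x u} → ((S ⊥) ⊥) x → x li u →
                  ∃ λ y → S y × (u li y)
  ⊥⊥-comparable lem {S} {x} {u} x∈S⊥⊥ x-li-u with lem {∃ λ y → S y × (u li y)}
  ... | yes comparable = comparable
  ... | no ¬comparable =
    ⊥-elim (x∈S⊥⊥ u (λ y Sy u-li-y → ¬comparable (y , Sy , u-li-y)) x-li-u)

  causallyClosed-resp : {S T : Subset} → SameSet S T → CausallyClosed S → CausallyClosed T
  causallyClosed-resp (S⊆T , T⊆S) (pre , post , event , convex) =
    (λ e h → S⊆T _ (pre e (λ b f → T⊆S _ (h b f)))) ,
    (λ e h → S⊆T _ (post e (λ b f → T⊆S _ (h b f)))) ,
    (λ e Te → let (ins , outs) = event e (T⊆S _ Te)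
              in (λ b f → S⊆T _ (ins b f)) , (λ b f → S⊆T _ (outs b f))) ,
    (λ x y z Tx Ty x-li-y between →
       S⊆T z (convex x y z (T⊆S x Tx) (T⊆S y Ty) x-li-y between))

  ⊥-causallyClosed : IsOccurrenceNet → (S : Subset) → CausallyClosed (S ⊥)
  ⊥-causallyClosed (in-unique , out-unique , _) S =
    pre-closed , post-closed , (λ e co-e → inputs e co-e , outputs e co-e) ,
    (λ _ _ _ co-x co-y _ → convex co-x co-y)
    where
    pre-closed : ∀ e → (∀ b → FBE b e → (S ⊥) (inj₁ b)) → (S ⊥) (inj₂ e)
    pre-closed e h w Sw (inj₁ e⊑w) =
      let (b , f) = event-pre e in h b f w Sw (inj₁ (be f ◅ e⊑w))
    pre-closed e h w Sw (inj₂ w⊑e) with ⊑-unsnoc w⊑e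
    ... | inj₁ refl = let (b , f) = event-pre e in h b f w Sw (inj₁ (be f ◅ ε))
    ... | inj₂ (_ , w⊑b , be f) = h _ f w Sw (inj₂ w⊑b)

    post-closed : ∀ e → (∀ b → FEB e b → (S ⊥) (inj₁ b)) → (S ⊥) (inj₂ e)
    post-closed e h w Sw (inj₂ w⊑e) =
      let (b , f) = event-post e in h b f w Sw (inj₂ (w⊑e ◅◅ eb f ◅ ε))
    post-closed e h w Sw (inj₁ ε) =
      let (b , f) = event-post e in h b f w Sw (inj₂ (eb f ◅ ε))
    post-closed e h w Sw (inj₁ (eb f ◅ b⊑w)) = h _ f w Sw (inj₁ b⊑w)

    inputs : ∀ e → (S ⊥) (inj₂ e) → ∀ b → FBE b e → (S ⊥) (inj₁ b)
    inputs e co-e b f w Sw (inj₂ w⊑b) = co-e w Sw (inj₂ (w⊑b ◅◅ be f ◅ ε))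
    inputs e co-e b f w Sw (inj₁ ε) = co-e w Sw (inj₂ (be f ◅ ε))
    inputs e co-e b f w Sw (inj₁ (be f′ ◅ e′⊑w)) =
      co-e w Sw (inj₁ (subst (λ e″ → inj₂ e″ ⊑ w) (out-unique b _ e f′ f) e′⊑w))

    outputs : ∀ e → (S ⊥) (inj₂ e) → ∀ b → FEB e b → (S ⊥) (inj₁ b)
    outputs e co-e b f w Sw (inj₁ b⊑w) = co-e w Sw (inj₁ (eb f ◅ b⊑w))
    outputs e co-e b f w Sw (inj₂ w⊑b) with ⊑-unsnoc w⊑b
    ... | inj₁ refl = co-e w Sw (inj₁ (eb f ◅ ε))
    ... | inj₂ (_ , w⊑e′ , eb f′) =
      co-e w Sw (inj₂ (subst (λ e″ → w ⊑ inj₂ e″) (in-unique b _ e f′ f) w⊑e′))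

    convex : ∀ {x y z} → (S ⊥) x → (S ⊥) y →
             ((x ⊑ z) × (z ⊑ y)) ⊎ ((y ⊑ z) × (z ⊑ x)) → (S ⊥) z
    convex co-x co-y (inj₁ (x⊑z , z⊑y)) w Sw (inj₁ z⊑w) = co-x w Sw (inj₁ (x⊑z ◅◅ z⊑w))
    convex co-x co-y (inj₁ (x⊑z , z⊑y)) w Sw (inj₂ w⊑z) = co-y w Sw (inj₂ (w⊑z ◅◅ z⊑y))
    convex co-x co-y (inj₂ (y⊑z , z⊑x)) w Sw (inj₁ z⊑w) = co-y w Sw (inj₁ (y⊑z ◅◅ z⊑w))
    convex co-x co-y (inj₂ (y⊑z , z⊑x)) w Sw (inj₂ w⊑z) = co-x w Sw (inj₂ (w⊑z ◅◅ z⊑x))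

  finite⇒repetition : {S : Subset} → Finite S → (u : ℕ → X) → (∀ n → S (u n)) →
                      ∃₂ λ i j → i < j × u i ≡ u j
  finite⇒repetition (xs , complete) u u∈S = repetition (pigeonhole (n<1+n (length xs)) slot)
    where
    position : ∀ n → u n ∈ xs
    position n = complete (u n) (u∈S n)

    slot : Fin (suc (length xs)) → Fin (length xs)
    slot i = index (position (toℕ i))

    repetition : ∃₂ (λ i j → i Fin.< j × slot i ≡ slot j) →
                 ∃₂ λ i j → i < j × u i ≡ u j
    repetition (i , j , i<j , same-slot) = toℕ i , toℕ j , i<j , (begin
      u (toℕ i)                   ≡⟨ lookup-index (position (toℕ i)) ⟩
      lookup xs (slot i)          ≡⟨ cong (lookup xs) same-slot ⟩
      lookup xs (slot j)          ≡⟨ lookup-index (position (toℕ j)) ⟨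
      u (toℕ j)                   ∎)
      where open ≡-Reasoning

  module DescendingChain (u : ℕ → X) (step : ∀ n → F (u (suc n)) (u n)) where

    chain-⊑ : ∀ {m n} → m ≤′ n → u n ⊑ u m
    chain-⊑ (≤′-reflexive refl) = ε
    chain-⊑ (≤′-step {n} m≤n)   = step n ◅ chain-⊑ m≤n

    chain-⁺ : ∀ {m n} → suc m ≤′ n → TransClosure F (u n) (u m)
    chain-⁺ {m} (≤′-reflexive refl) = [ step m ]
    chain-⁺ (≤′-step {n} m<n)        = step n ∷ chain-⁺ m<n

    chain-li : ∀ m n → u m li u n
    chain-li m n with ≤-total m n
    ... | inj₁ m≤n = inj₂ (chain-⊑ (≤⇒≤′ m≤n))
    ... | inj₂ n≤m = inj₁ (chain-⊑ (≤⇒≤′ n≤m))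

    chain-injective : IsOccurrenceNet → ∀ {m n} → m < n → u m ≢ u n
    chain-injective (_ , _ , acyclic) {n = n} m<n um≡un = acyclic (u n) (u n) cycle cycle
      where cycle = subst (TransClosure F (u n)) um≡un (chain-⁺ (≤⇒≤′ m<n))

  -- P is extended to a cut and D to a line; K-density makes them meet in w,
  -- and w cannot lie above any d ∈ D since d lies above some p ∈ P.
  kdense⇒lowerBound : KDense → (P D : Subset) →
    (∀ x y → P x → P y → x ≢ y → x co y) → (∀ x y → D x → D y → x li y) →
    (∀ d → D d → ∃ λ p → P p × (p ⊑ d)) → (∀ d p → D d → P p → ¬ d ⊑ p) →
    ∃ λ w → ∀ d → D d → w ⊑ d
  kdense⇒lowerBound kd P D P-co D-li P-below D-not-below = w , w-below
    where
    module C = GreedyExtension code code-injective _co_ co-sym P P-co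
    module L = GreedyExtension code code-injective _li_ li-sym D (λ x y Dx Dy _ → D-li x y Dx Dy)

    line-pairwise : ∀ x y → L.Extension x → L.Extension y → x li y
    line-pairwise x y Lx Ly with x ≟ y
    ... | yes refl = inj₁ ε
    ... | no x≢y   = L.extension-pairwise x y Lx Ly x≢y

    meet : ∃ λ w → C.Extension w × L.Extension w
    meet = kd C.Extension L.Extension (C.extension-pairwise , C.extension-maximal)
                                     (line-pairwise , L.extension-maximal)

    w : X
    w = proj₁ meet

    w-below : ∀ d → D d → w ⊑ d
    w-below d Dd with line-pairwise w d (proj₂ (proj₂ meet)) (inj₁ Dd)
    ... | inj₁ w⊑d = w⊑d
    ... | inj₂ d⊑w with P-below d Dd
    ...   | p , Pp , p⊑d with w ≟ p
    ...     | yes refl = ⊥-elim (D-not-below d p Dd Pp d⊑w)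
    ...     | no w≢p   =
      ⊥-elim (C.extension-pairwise w p (proj₁ (proj₂ meet)) (inj₁ Pp) w≢p (inj₂ (p⊑d ◅◅ d⊑w)))

module CausalClosure (lem : ExcludedMiddle 0ℓ) (N : Net) (occ : Net.IsOccurrenceNet N)
                     (Y : Net.Subset N) (cc : Net.CausallyClosed N Y) where
  open Net N
  open NetProperties N

  out-unique : ∀ b e e′ → FBE b e → FBE b e′ → e ≡ e′
  out-unique = proj₁ (proj₂ occ)

  pre-closed : ∀ e → (∀ b → FBE b e → Y (inj₁ b)) → Y (inj₂ e)
  pre-closed = proj₁ cc

  post-closed : ∀ {e b} → Y (inj₂ e) → FEB e b → Y (inj₁ b)
  post-closed Ye = proj₂ (proj₁ (proj₂ (proj₂ cc)) _ Ye) _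

  convex : ∀ {x y z} → Y x → Y y → x ⊑ z → z ⊑ y → Y z
  convex Yx Yy x⊑z z⊑y =
    proj₂ (proj₂ (proj₂ cc)) _ _ _ Yx Yy (inj₁ (x⊑z ◅◅ z⊑y)) (inj₁ (x⊑z , z⊑y))

  Frontier : Subset
  Frontier (inj₁ b) = Y (inj₁ b) × ∃ λ e → FBE b e × ¬ Y (inj₂ e)
  Frontier (inj₂ _) = Empty

  frontier⊆Y : ∀ x → Frontier x → Y x
  frontier⊆Y (inj₁ b) = proj₁

  frontier-below : ∀ {y w} → y ⊑ w → Y y → ¬ Y w → ∃ λ b → Frontier b × (b ⊑ w)
  frontier-below ε Yy ¬Yw = ⊥-elim (¬Yw Yy)
  frontier-below {y} (_◅_ {j = z} f z⊑w) Yy ¬Yw with lem {Y z} | f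
  ... | yes Yz | _    = frontier-below z⊑w Yz ¬Yw
  ... | no ¬Yz | eb g = ⊥-elim (¬Yz (post-closed Yy g))
  ... | no ¬Yz | be g = y , (Yy , _ , g , ¬Yz) , be g ◅ z⊑w

  frontier-⊑ : ∀ x y → Frontier x → Frontier y → x ⊑ y → x ≡ y
  frontier-⊑ _ _ _ _ ε = refl
  frontier-⊑ (inj₁ b) (inj₁ c) (Yb , e , g , ¬Ye) (Yc , _) (be f ◅ e′⊑c) =
    ⊥-elim (¬Ye (subst (λ e″ → Y (inj₂ e″)) (out-unique b _ _ f g)
                       (convex Yb Yc (be f ◅ ε) e′⊑c)))

  frontier-co : ∀ x y → Frontier x → Frontier y → x ≢ y → x co y
  frontier-co x y Fx Fy x≢y (inj₁ x⊑y) = x≢y (frontier-⊑ x y Fx Fy x⊑y)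
  frontier-co x y Fx Fy x≢y (inj₂ y⊑x) = x≢y (sym (frontier-⊑ y x Fy Fx y⊑x))

  NothingAbove : X → Set
  NothingAbove u = ∀ y → Y y → ¬ u ⊑ y

  module Below (x : X) (x∈Y⊥⊥ : ((Y ⊥) ⊥) x) where

    Stranded : X → Set
    Stranded u = ¬ Y u × (u ⊑ x) × NothingAbove u

    stranded-above-Y : ∀ {u} → Stranded u → ∃ λ y → Y y × (y ⊑ u)
    stranded-above-Y (_ , u⊑x , nothing-above) with ⊥⊥-comparable lem x∈Y⊥⊥ (inj₂ u⊑x)
    ... | y , Yy , inj₁ u⊑y = ⊥-elim (nothing-above y Yy u⊑y)
    ... | y , Yy , inj₂ y⊑u = y , Yy , y⊑u

    nothing-above-pred : ∀ {y v} → Y y → y ⊑ v → ¬ Y v → NothingAbove v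
    nothing-above-pred Yy y⊑v ¬Yv y′ Yy′ v⊑y′ = ¬Yv (convex Yy Yy′ y⊑v v⊑y′)

    -- An event outside Y has an input condition outside Y, and that condition
    -- has no output but e, so nothing of Y is above it either.
    stranded-input : ∀ {b e} → FBE b e → Stranded (inj₂ e) →
                     ∃ λ v → F v (inj₂ e) × Stranded v
    stranded-input {e = e} _ (¬Ye , e⊑x , nothing-above)
      with lem {∃ λ b → FBE b e × ¬ Y (inj₁ b)}
    ... | no all-in =
      ⊥-elim (¬Ye (pre-closed e λ b f → em⇒dne lem λ ¬Yb → all-in (b , f , ¬Yb)))
    ... | yes (b , f , ¬Yb) = inj₁ b , be f , ¬Yb , be f ◅ e⊑x , nothing-above-b
      where
      nothing-above-b : NothingAbove (inj₁ b)
      nothing-above-b y Yy ε = ¬Yb Yy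
      nothing-above-b y Yy (be g ◅ e′⊑y) =
        nothing-above y Yy (subst (λ e″ → inj₂ e″ ⊑ y) (out-unique b _ _ g f) e′⊑y)

    stranded-pred : ∀ {u} → Stranded u → ∃ λ v → F v u × Stranded v
    stranded-pred {u} st@(¬Yu , u⊑x , _) with stranded-above-Y st
    ... | y , Yy , y⊑u with ⊑-unsnoc y⊑u
    ...   | inj₁ refl = ⊥-elim (¬Yu Yy)
    ...   | inj₂ (v , y⊑v , f) with lem {Y v} | f
    ...     | no ¬Yv | _    = v , f , ¬Yv , f ◅ u⊑x , nothing-above-pred Yy y⊑v ¬Yv
    ...     | yes Yv | eb g = ⊥-elim (¬Yu (post-closed Yv g))
    ...     | yes Yv | be g = stranded-input g st

    module Chain (x-stranded : Stranded x) where

      link : ℕ → Σ X Stranded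
      link zero    = x , x-stranded
      link (suc n) = let (v , _ , v-stranded) = stranded-pred (proj₂ (link n)) in v , v-stranded

      u : ℕ → X
      u n = proj₁ (link n)

      u-stranded : ∀ n → Stranded (u n)
      u-stranded n = proj₂ (link n)

      u-step : ∀ n → F (u (suc n)) (u n)
      u-step n = proj₁ (proj₂ (stranded-pred (u-stranded n)))

      open DescendingChain u u-step public

      frontier-below-u : ∀ n → ∃ λ b → Frontier b × (b ⊑ u n)
      frontier-below-u n with stranded-above-Y (u-stranded n)
      ... | y , Yy , y⊑u = frontier-below y⊑u Yy (proj₁ (u-stranded n))

      lowerBound : KDense → ∃ λ w → ∀ n → w ⊑ u n
      lowerBound kd with kdense⇒lowerBound kd Frontier (λ z → ∃ λ n → u n ≡ z) frontier-co
        (λ { _ _ (m , refl) (n , refl) → chain-li m n })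
        (λ { _ (n , refl) → frontier-below-u n })
        (λ { _ b (n , refl) Fb → proj₂ (proj₂ (u-stranded n)) b (frontier⊆Y b Fb) })
      ... | w , w⊑ = w , λ n → w⊑ (u n) (n , refl)

  Y⊥⊥-above-Y⊆Y : KDense → IntervalFinite →
                  ∀ x → ((Y ⊥) ⊥) x → ∀ y → Y y → y ⊑ x → Y x
  Y⊥⊥-above-Y⊆Y kd ifin x x∈Y⊥⊥ y Yy y⊑x = em⇒dne lem λ ¬Yx →
    let open Chain (¬Yx , ε , nothing-above-pred Yy y⊑x ¬Yx)
        (w , w⊑u) = lowerBound kd
        (i , j , i<j , ui≡uj) = finite⇒repetition (ifin w x) u
                                  (λ n → w⊑u n , proj₁ (proj₂ (u-stranded n)))
    in chain-injective occ i<j ui≡uj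
    where open Below x x∈Y⊥⊥

dual : Net → Net
dual N = record
  { B = B ; E = E ; FBE = λ b e → FEB e b ; FEB = λ e b → FBE b e
  ; B-countable = B-countable ; E-countable = E-countable
  ; event-pre = event-post ; event-post = event-pre }
  where open Net N

module Duality (N : Net) where
  open Net N
  module D = Net (dual N)

  F-undual : Sym D.F F
  F-undual (D.be f) = eb f
  F-undual (D.eb f) = be f

  F-dual : Sym F D.F
  F-dual (be f) = D.eb f
  F-dual (eb f) = D.be f

  ⊑-undual : Sym D._⊑_ _⊑_
  ⊑-undual = reverse F-undual

  ⊑-dual : Sym _⊑_ D._⊑_
  ⊑-dual = reverse F-dual

  ⁺-undual : Sym (TransClosure D.F) (TransClosure F)
  ⁺-undual [ f ]   = [ F-undual f ]
  ⁺-undual (f ∷ r) = ⁺-undual r ∷ʳ F-undual f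

  li-undual : ∀ {x y} → x D.li y → x li y
  li-undual (inj₁ p) = inj₂ (⊑-undual p)
  li-undual (inj₂ p) = inj₁ (⊑-undual p)

  li-dual : ∀ {x y} → x li y → x D.li y
  li-dual (inj₁ p) = inj₂ (⊑-dual p)
  li-dual (inj₂ p) = inj₁ (⊑-dual p)

  occurrenceNet-dual : IsOccurrenceNet → D.IsOccurrenceNet
  occurrenceNet-dual (in-unique , out-unique , acyclic) =
    out-unique , in-unique , λ x y p q → acyclic y x (⁺-undual p) (⁺-undual q)

  kdense-dual : KDense → D.KDense
  kdense-dual kd c l (c-co , c-max) (l-li , l-max) = kd c l
    ((λ x y cx cy x≢y x-li-y → c-co x y cx cy x≢y (li-dual x-li-y)) ,
     (λ x x∉c all-co → c-max x x∉c (λ y cy x-li-y → all-co y cy (li-undual x-li-y))))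
    ((λ x y lx ly → li-undual (l-li x y lx ly)) ,
     (λ x x∉l all-li → l-max x x∉l (λ y ly → li-dual (all-li y ly))))

  intervalFinite-dual : IntervalFinite → D.IntervalFinite
  intervalFinite-dual ifin x y =
    proj₁ (ifin y x) ,
    λ z (x⊑z , z⊑y) → proj₂ (ifin y x) z (⊑-undual z⊑y , ⊑-undual x⊑z)

  causallyClosed-dual : ∀ {Y} → CausallyClosed Y → D.CausallyClosed Y
  causallyClosed-dual (pre , post , event , convex) =
    post , pre , (λ e Ye → swap (event e Ye)) ,
    λ x y z Yx Yy x-li-y between →
      convex x y z Yx Yy (li-undual x-li-y) (between-undual between)
    where
    between-undual : ∀ {x y z} → ((x D.⊑ z) × (z D.⊑ y)) ⊎ ((y D.⊑ z) × (z D.⊑ x))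
                     → ((x ⊑ z) × (z ⊑ y)) ⊎ ((y ⊑ z) × (z ⊑ x))
    between-undual (inj₁ (x⊑z , z⊑y)) = inj₂ (⊑-undual z⊑y , ⊑-undual x⊑z)
    between-undual (inj₂ (y⊑z , z⊑x)) = inj₁ (⊑-undual z⊑x , ⊑-undual y⊑z)

  ⊥⊥-dual : ∀ {Y x} → ((Y ⊥) ⊥) x → D._⊥ (D._⊥ Y) x
  ⊥⊥-dual x∈Y⊥⊥ w w∈Y⊥ x-li-w =
    x∈Y⊥⊥ w (λ y Yy w-li-y → w∈Y⊥ y Yy (li-dual w-li-y)) (li-undual x-li-w)

causallyClosed⇒closed : ExcludedMiddle 0ℓ → (N : Net) → let open Net N in
  IsOccurrenceNet → KDense → IntervalFinite → (Y : Subset) → CausallyClosed Y → Closed Y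
causallyClosed⇒closed lem N occ kd ifin Y cc = ⊆-⊥⊥ Y , Y⊥⊥⊆Y
  where
  open Net N
  open NetProperties N using (⊆-⊥⊥; ⊥⊥-comparable)
  open Duality N

  Y⊥⊥⊆Y : ∀ x → ((Y ⊥) ⊥) x → Y x
  Y⊥⊥⊆Y x x∈Y⊥⊥ with ⊥⊥-comparable lem x∈Y⊥⊥ (inj₁ ε)
  ... | y , Yy , inj₂ y⊑x =
    CausalClosure.Y⊥⊥-above-Y⊆Y lem N occ Y cc kd ifin x x∈Y⊥⊥ y Yy y⊑x
  ... | y , Yy , inj₁ x⊑y =
    CausalClosure.Y⊥⊥-above-Y⊆Y lem (dual N) (occurrenceNet-dual occ) Y
      (causallyClosed-dual cc) (kdense-dual kd) (intervalFinite-dual ifin)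
      x (⊥⊥-dual x∈Y⊥⊥) y Yy (⊑-dual x⊑y)

closed⇒causallyClosed : (N : Net) → let open Net N in
  IsOccurrenceNet → (Y : Subset) → Closed Y → CausallyClosed Y
closed⇒causallyClosed N occ Y closed =
  causallyClosed-resp (swap closed) (⊥-causallyClosed occ (Y ⊥))
  where
  open Net N
  open NetProperties N

theorem2 : ExcludedMiddle 0ℓ → (N : Net) → let open Net N in
    IsOccurrenceNet → KDense → IntervalFinite → DegreeFinite →
    (Y : Subset) → (CausallyClosed Y → Closed Y) × (Closed Y → CausallyClosed Y)
theorem2 lem N occ kd ifin _ Y =
  causallyClosed⇒closed lem N occ kd ifin Y , closed⇒causallyClosed N occ Y
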